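{- Let $\mathcal{K}_\succ=(\langle\mathcal{T},\mathcal{A}\rangle,\succ)$ be a prioritized KB. Then $\mathit{Elect}(\mathcal{K}_\succ)\subseteq\mathcal{G}$, where $\mathcal{G}$ is the grounded extension of $F_{\mathcal{K},\succ}$.
   Context: $\mathcal{K}=\langle\mathcal{T},\mathcal{A}\rangle$: description-logic TBox and finite ABox. A conflict is an inclusion-minimal subset $C\subseteq\mathcal{A}$ such that $\langle\mathcal{T},C\rangle$ has no model; $\mathit{conf}(\mathcal{K})$ the set of conflicts; standing assumption: every conflict has at least two assertions. Priority relation $\succ$: acyclic binary relation on $\mathcal{A}$ with $\alpha\succ\beta$ only if $\{\alpha,\beta\}\subseteq C\in\mathit{conf}(\mathcal{K})$. An assertion $\alpha\in\mathcal{A}$ is elected iff for every $C\in\mathit{conf}(\mathcal{K})$ with $\alpha\in C$ there exists $\beta\in C$ with $\alpha\succ\beta$; $\mathit{Elect}(\mathcal{K}_\succ)$ is the set of elected assertions. Grounded extension $\mathcal{G}$ of $F_{\mathcal{K},\succ}$: let $\rightsquigarrow=\{(C\setminus\{\alpha\},\alpha)\mid C\in\mathit{conf}(\mathcal{K}),\alpha\in C\}$, $S\rightsquigarrow_\succ\alpha$ iff $S\rightsquigarrow\alpha$ and $\alpha\not\succ\beta$ for all $\beta\in S$, $S^+=\{\alpha\mid\exists T\subseteq S,T\rightsquigarrow_\succ\alpha\}$, $\Gamma(S)=\{\alpha\mid\forall T\rightsquigarrow_\succ\alpha,\ T\cap S^+\neq\emptyset\}$; $\mathcal{G}$ is the least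 fixpoint of $\Gamma$. -}

module Defs where

open import Data.Nat using (ℕ; _≤_)
open import Data.Fin using (Fin)
open import Data.Fin.Subset using (Subset; _∈_; _⊆_; _⊂_; _-_; ∣_∣)
open import Data.Product using (Σ; ∃; ∃-syntax; _×_)
open import Relation.Nullary using (¬_)
open import Relation.Binary.PropositionalEquality using (_≡_)
open import Relation.Binary.Construct.Closure.Transitive using (TransClosure)

-- The ABox A is a finite set of n assertions, indexed by Fin n; subsets of A
-- are elements of Subset n.  The TBox T together with its model-theoretic
-- semantics is abstracted by the predicate  Incons C  :  "<T , C> has no model".
record KB (n : ℕ) : Set₁ where
  field
    Incons      : Subset n → Set
    Incons-mono : ∀ {C D : Subset n} → C ⊆ D → Incons C → Incons D

module _ {n : ℕ} (K : KB n) where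
  open KB K

  IsConflict : Subset n → Set
  IsConflict C = Incons C × (∀ D → D ⊂ C → ¬ Incons D)

  ConflictsAtLeastTwo : Set
  ConflictsAtLeastTwo = ∀ C → IsConflict C → 2 ≤ ∣ C ∣

  IsPriority : (Fin n → Fin n → Set) → Set
  IsPriority _≻_ =
    (∀ α → ¬ TransClosure _≻_ α α) ×
    (∀ α β → α ≻ β → ∃[ C ] (IsConflict C × α ∈ C × β ∈ C))

  module _ (_≻_ : Fin n → Fin n → Set) where

    Elect : Fin n → Set
    Elect α = ∀ C → IsConflict C → α ∈ C → ∃[ β ] (β ∈ C × α ≻ β)

    _⇝_ : Subset n → Fin n → Set
    S ⇝ α = ∃[ C ] (IsConflict C × α ∈ C × S ≡ C - α)

    _⇝≻_ : Subset n → Fin n → Set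
    S ⇝≻ α = (S ⇝ α) × (∀ β → β ∈ S → ¬ (α ≻ β))

    _⁺ : Subset n → Fin n → Set
    (S ⁺) α = ∃[ T ] (T ⊆ S × T ⇝≻ α)

    Γ : Subset n → Fin n → Set
    Γ S α = ∀ T → T ⇝≻ α → ∃[ β ] (β ∈ T × (S ⁺) β)

    IsFixpoint : Subset n → Set
    IsFixpoint S = ∀ α → (α ∈ S → Γ S α) × (Γ S α → α ∈ S)

    IsGrounded : Subset n → Set
    IsGrounded G = IsFixpoint G × (∀ S → IsFixpoint S → G ⊆ S)

module Submission where

-- The argument is that an elected assertion is unattackable.  Suppose
-- C ∖ {α} ⇝≻ α for a conflict C ∋ α.  Election gives β ∈ C with α ≻ β;
-- acyclicity of ≻ makes it irreflexive, so β ≠ α and hence β ∈ C ∖ {α}.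
-- But a ≻-attack on α requires α ⊁ β for every member β of the attacking
-- set, a contradiction.  An assertion with no ≻-attackers is vacuously
-- defended by every set S (the condition of Γ S α quantifies over the
-- empty collection of attacks), so it lies in Γ S for all S, and therefore
-- in every fixpoint of Γ, in particular in the grounded extension.

open import Defs
open import Data.Nat using (ℕ)
open import Data.Fin using (Fin)
open import Data.Fin.Subset using (Subset; _∈_)
open import Data.Fin.Subset.Properties using (x∈p∧x≢y⇒x∈p-y)
open import Data.Product using (_,_; proj₂)
open import Relation.Nullary using (¬_)
open import Relation.Binary.PropositionalEquality using (_≢_; subst; sym)
open import Relation.Binary.Construct.Closure.Transitive using (TransClosure; [_])

acyclic⇒irreflexive : ∀ {n} {_≻_ : Fin n → Fin n → Set} →
  (∀ α → ¬ TransClosure _≻_ α α) → ∀ {α β} → α ≻ β → β ≢ α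
acyclic⇒irreflexive {_≻_ = _≻_} acyclic {α} α≻β β≡α =
  acyclic α [ subst (α ≻_) β≡α α≻β ]

module _ {n : ℕ} (K : KB n) (_≻_ : Fin n → Fin n → Set) where

  Unattacked : Fin n → Set
  Unattacked α = ∀ T → ¬ _⇝≻_ K _≻_ T α

  -- An elected assertion is unattacked, provided ≻ is irreflexive: the
  -- assertion it is preferred to inside the conflict lies in the attacking set.
  elected⇒unattacked : (∀ {α β} → α ≻ β → β ≢ α) →
    ∀ α → Elect K _≻_ α → Unattacked α
  elected⇒unattacked irrefl α elected T ((C , conflict , α∈C , T≡C-α) , noPreference)
    with elected C conflict α∈C
  ... | β , β∈C , α≻β = noPreference β β∈T α≻β
    where
    β∈T : β ∈ T
    β∈T = subst (β ∈_) (sym T≡C-α) (x∈p∧x≢y⇒x∈p-y β∈C (irrefl α≻β))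

  unattacked⇒defended : ∀ α → Unattacked α → ∀ S → Γ K _≻_ S α
  unattacked⇒defended α unattacked S T T⇝≻α with unattacked T T⇝≻α
  ... | ()

  unattacked⇒inFixpoint : ∀ α → Unattacked α →
    ∀ S → IsFixpoint K _≻_ S → α ∈ S
  unattacked⇒inFixpoint α unattacked S fixpoint =
    proj₂ (fixpoint α) (unattacked⇒defended α unattacked S)

mainTheorem7 : (n : ℕ) (K : KB n) → ConflictsAtLeastTwo K →
    (_≻_ : Fin n → Fin n → Set) → IsPriority K _≻_ →
    (G : Subset n) → IsGrounded K _≻_ G →
    ∀ α → Elect K _≻_ α → α ∈ G
mainTheorem7 n K _ _≻_ (acyclic , _) G (fixpoint , _) α elected =
  unattacked⇒inFixpoint K _≻_ α
    (elected⇒unattacked K _≻_ (acyclic⇒irreflexive acyclic) α elected)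
    G fixpoint
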